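{- Let $G$ be a finite simple graph with maximum degree $\Delta$, let $\alpha$ be a proper $(\Delta+1)$-edge-coloring of $G$, and suppose each vertex $x$ has been assigned a color $m_\alpha(x)\in\{1,\dots,\Delta+1\}$ missing in $\alpha$ at $x$. Let $u$ be a vertex, $uv$ an edge, and let $X_u(\alpha,v)=(ux_0,ux_1,\dots,ux_p)$ (with $x_0=v$) be the $\alpha$-fan at $u$ starting with $uv$. Suppose $X_u(\alpha,v)$ is a path, i.e. the color $m_\alpha(x_p)$ is missing in $\alpha$ at $u$. Let $\alpha'$ be the coloring defined by $\alpha'(ux_i)=m_\alpha(x_i)$ for $i=0,1,\dots,p$ and $\alpha'(e)=\alpha(e)$ for every other edge $e$. Then $\alpha$ and $\alpha'$ are $K$-equivalent.
   Context: A proper $t$-coloring of $G$ is a map $E(G)\to\{1,\dots,t\}$ giving adjacent edges distinct colors. A color $c$ is missing in $\alpha$ at $x$ if no edge incident to $x$ has color $c$. An $\alpha$-fan at $u$ is a sequence of edges $(ux_0,\dots,ux_p)$ incident with $u$ (distinct neighbors $x_i$) such that $m_\alpha(x_i)=\alpha(ux_{i+1})$ for $i=0,\dots,p-1$, and either $m_\alpha(x_p)$ is missing at $u$ or $m_\alpha(x_p)\in\{\alpha(ux_0),\dots,\alpha(ux_{p-1})\}$; for each edge $uv$ there is a unique such fan with $x_0=v$, denoted $X_u(\alpha,v)$. Given a proper edge coloring and two distinct colors $c,d$, a Kempe chain is a connected component of the subgraph formed by the edges colored $c$ or $d$; a $K$-change swaps the two colors on a Kempe chain. Two $(\Delta+1)$-colorings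 are $K$-equivalent if one can be obtained from the other by a finite sequence of $K$-changes using only colors from $\{1,\dots,\Delta+1\}$. -}

module Defs where

open import Data.Nat using (ℕ; zero; suc; _⊔_)
open import Data.Bool using (Bool; true; false; T; if_then_else_)
open import Data.Fin using (Fin; zero; suc; inject₁; fromℕ)
open import Data.List using (List; map; foldr; allFin)
open import Data.Nat.ListAction using (sum)
open import Data.Product using (Σ; ∃; _×_; _,_)
open import Data.Sum using (_⊎_)
open import Relation.Nullary using (¬_)
open import Relation.Binary.PropositionalEquality using (_≡_; _≢_)
open import Relation.Binary.Construct.Closure.ReflexiveTransitive using (Star)

record Graph : Set where
  field
    n      : ℕ
    adj    : Fin n → Fin n → Bool
    adj-sym    : ∀ x y → adj x y ≡ adj y x
    adj-irrefl : ∀ x → adj x x ≡ false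

module _ (G : Graph) where
  open Graph G

  Adj : Fin n → Fin n → Set
  Adj x y = T (adj x y)

  degree : Fin n → ℕ
  degree x = sum (map (λ y → if adj x y then 1 else 0) (allFin n))

  maxDegree : ℕ
  maxDegree = foldr _⊔_ 0 (map degree (allFin n))

  module _ {k : ℕ} where
    -- An edge coloring with colors Fin k is a map on ordered pairs; only its
    -- values on edges (a, b) with Adj a b matter, and it must be symmetric there.
    Coloring : Set
    Coloring = Fin n → Fin n → Fin k

    IsProper : Coloring → Set
    IsProper α = (∀ x y → Adj x y → α x y ≡ α y x)
               × (∀ x y z → Adj x y → Adj x z → y ≢ z → α x y ≢ α x z)

    Missing : Coloring → Fin n → Fin k → Set
    Missing α x c = ∀ y → Adj x y → α x y ≢ c

    -- xs : Fin (suc p) → Fin n is the sequence x_0, …, x_p ;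
    -- IsFan α m u v p xs : (u x_0, …, u x_p) is an α-fan at u with x_0 = v.
    IsFan : Coloring → (Fin n → Fin k) → Fin n → Fin n →
            (p : ℕ) → (Fin (suc p) → Fin n) → Set
    IsFan α m u v p xs =
        (xs zero ≡ v)
      × (∀ i → Adj u (xs i))
      × (∀ i j → xs i ≡ xs j → i ≡ j)
      × (∀ (i : Fin p) → m (xs (inject₁ i)) ≡ α u (xs (suc i)))
      × (Missing α u (m (xs (fromℕ p)))
           ⊎ Σ (Fin p) (λ i → m (xs (fromℕ p)) ≡ α u (xs (inject₁ i))))

    data Reach (α : Coloring) (c d : Fin k) (w : Fin n) : Fin n → Set where
      here : Reach α c d w w
      step : ∀ {a b} → Reach α c d w a → Adj a b →
             (α a b ≡ c ⊎ α a b ≡ d) → Reach α c d w b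

    -- β is obtained from α by swapping colors c and d on the Kempe chain
    -- (the component of the c/d-subgraph) containing the vertex w.
    KChange : Coloring → Coloring → Set
    KChange α β = Σ (Fin k) λ c → Σ (Fin k) λ d → c ≢ d × Σ (Fin n) λ w →
      ∀ a b → Adj a b →
          (Reach α c d w a → α a b ≡ c → β a b ≡ d)
        × (Reach α c d w a → α a b ≡ d → β a b ≡ c)
        × ((¬ Reach α c d w a ⊎ (α a b ≢ c × α a b ≢ d)) → β a b ≡ α a b)

    AgreeOnEdges : Coloring → Coloring → Set
    AgreeOnEdges α β = ∀ a b → Adj a b → α a b ≡ β a b

    -- K-equivalence: finite sequence of K-changes (up to equality on edges)
    KEquivalent : Coloring → Coloring → Set
    KEquivalent α β = Σ Coloring λ γ → Star KChange α γ × AgreeOnEdges γ β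

{-# OPTIONS --safe #-}
-- Recolour the fan edges one at a time, starting from the last one. Since
-- m(x_p) is missing at both u and x_p, the Kempe chain of colours m(x_p) and
-- α(ux_p) through u is the single edge ux_p, so swapping it is a K-change that
-- gives ux_p its target colour. Afterwards α(ux_p) = m(x_{p-1}) is missing at
-- u, so the first p edges again form a path fan and the argument repeats.
module Submission where

open import Defs
open import Data.Nat using (ℕ; suc; zero)
open import Data.Fin using (Fin; fromℕ; inject₁; zero; suc; _≟_)
open import Data.Fin.Properties using (inject₁-injective; fromℕ≢inject₁)
open import Data.Fin.Relation.Unary.Top using (view; ‵fromℕ; ‵inject₁)
open import Data.Product using (_×_; _,_; proj₁; proj₂)
open import Data.Sum using (_⊎_; inj₁; inj₂)
open import Data.Empty using (⊥-elim)
open import Data.Bool using (T)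
open import Function using (_∘_)
open import Relation.Nullary using (¬_; Dec; yes; no)
open import Relation.Nullary.Decidable using (_×-dec_; _⊎-dec_; toSum)
open import Relation.Binary.PropositionalEquality using (_≡_; _≢_; refl; sym; trans; subst)
open import Relation.Binary.Construct.Closure.ReflexiveTransitive using (ε; _◅_)

private
  variable
    n : ℕ
    u x a b y z : Fin n

OnEdge : Fin n → Fin n → Fin n → Fin n → Set
OnEdge u x a b = (a ≡ u × b ≡ x) ⊎ (a ≡ x × b ≡ u)

onEdge? : (u x a b : Fin n) → Dec (OnEdge u x a b)
onEdge? u x a b = ((a ≟ u) ×-dec (b ≟ x)) ⊎-dec ((a ≟ x) ×-dec (b ≟ u))

OnEdge-sym : OnEdge u x a b → OnEdge u x b a
OnEdge-sym (inj₁ (a≡u , b≡x)) = inj₂ (b≡x , a≡u)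
OnEdge-sym (inj₂ (a≡x , b≡u)) = inj₁ (b≡u , a≡x)

OnEdge-start : OnEdge u x a b → a ≡ u ⊎ a ≡ x
OnEdge-start (inj₁ (a≡u , _)) = inj₁ a≡u
OnEdge-start (inj₂ (a≡x , _)) = inj₂ a≡x

OnEdge-end : OnEdge u x a b → b ≡ u ⊎ b ≡ x
OnEdge-end = OnEdge-start ∘ OnEdge-sym

OnEdge-unique : OnEdge u x a y → OnEdge u x a z → y ≡ z
OnEdge-unique (inj₁ (refl , refl)) (inj₁ (_ , refl))    = refl
OnEdge-unique (inj₁ (refl , refl)) (inj₂ (x≡u , refl)) = sym x≡u
OnEdge-unique (inj₂ (refl , refl)) (inj₁ (u≡x , refl)) = sym u≡x
OnEdge-unique (inj₂ (refl , refl)) (inj₂ (_ , refl))    = refl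

module _ (G : Graph) {k : ℕ} where
  open Graph G using (adj-sym; adj-irrefl) renaming (n to V)

  Adj-sym : ∀ {a b} → Adj G a b → Adj G b a
  Adj-sym {a} {b} = subst T (adj-sym a b)

  Adj⇒≢ : ∀ {a b} → Adj G a b → a ≢ b
  Adj⇒≢ {a} h refl = subst T (adj-irrefl a) h

  _◅ᴷ_ : ∀ {α β γ : Coloring G {k}} → KChange G α β → KEquivalent G β γ → KEquivalent G α γ
  κ ◅ᴷ (δ , changes , agree) = δ , κ ◅ changes , agree

  AgreeOnEdges⇒KEquivalent : ∀ {α β : Coloring G {k}} → AgreeOnEdges G α β → KEquivalent G α β
  AgreeOnEdges⇒KEquivalent {α} agree = α , ε , agree

  recolorEdge : Coloring G {k} → Fin V → Fin V → Fin k → Coloring G {k}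
  recolorEdge α u x c a b with onEdge? u x a b
  ... | yes _ = c
  ... | no  _ = α a b

  module _ {α : Coloring G {k}} {u x : Fin V} {c : Fin k} {a b : Fin V} where

    recolorEdge-on : OnEdge u x a b → recolorEdge α u x c a b ≡ c
    recolorEdge-on e with onEdge? u x a b
    ... | yes _ = refl
    ... | no ¬e = ⊥-elim (¬e e)

    recolorEdge-off : ¬ OnEdge u x a b → recolorEdge α u x c a b ≡ α a b
    recolorEdge-off ¬e with onEdge? u x a b
    ... | yes e = ⊥-elim (¬e e)
    ... | no _  = refl

  module _ {α : Coloring G {k}} (proper : IsProper G α) {u x : Fin V} {c : Fin k}
           (ux : Adj G u x) (c∉u : Missing G α u c) (c∉x : Missing G α x c) where
    private
      symmetric : ∀ a b → Adj G a b → α a b ≡ α b a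
      symmetric = proj₁ proper

      distinct : ∀ a y z → Adj G a y → Adj G a z → y ≢ z → α a y ≢ α a z
      distinct = proj₂ proper

      β : Coloring G {k}
      β = recolorEdge α u x c

      Endpoint : Fin V → Set
      Endpoint a = a ≡ u ⊎ a ≡ x

      c∉endpoint : ∀ {a} → Endpoint a → Missing G α a c
      c∉endpoint (inj₁ refl) = c∉u
      c∉endpoint (inj₂ refl) = c∉x

      OnEdge-colour : ∀ {a b} → OnEdge u x a b → α a b ≡ α u x
      OnEdge-colour (inj₁ (refl , refl)) = refl
      OnEdge-colour (inj₂ (refl , refl)) = sym (symmetric u x ux)

      colour-OnEdge : ∀ {a b} → Endpoint a → Adj G a b → α a b ≡ α u x → OnEdge u x a b
      colour-OnEdge {b = b} (inj₁ refl) ab same with b ≟ x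
      ... | yes b≡x = inj₁ (refl , b≡x)
      ... | no  b≢x = ⊥-elim (distinct u b x ab ux b≢x same)
      colour-OnEdge {b = b} (inj₂ refl) ab same with b ≟ u
      ... | yes b≡u = inj₂ (refl , b≡u)
      ... | no  b≢u = ⊥-elim (distinct x b u ab (Adj-sym ux) b≢u
                                (trans same (symmetric u x ux)))

      chain⊆edge : ∀ {a} → Reach G α c (α u x) u a → Endpoint a
      chain⊆edge here                    = inj₁ refl
      chain⊆edge (step r ab (inj₁ ≡c))   = ⊥-elim (c∉endpoint (chain⊆edge r) _ ab ≡c)
      chain⊆edge (step r ab (inj₂ ≡αux)) = OnEdge-end (colour-OnEdge (chain⊆edge r) ab ≡αux)

      edge⊆chain : ∀ {a} → Endpoint a → Reach G α c (α u x) u a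
      edge⊆chain (inj₁ refl) = here
      edge⊆chain (inj₂ refl) = step here ux (inj₂ refl)

    recolorEdge-proper : IsProper G (recolorEdge α u x c)
    recolorEdge-proper = β-symmetric , β-distinct
      where
      β-symmetric : ∀ a b → Adj G a b → β a b ≡ β b a
      β-symmetric a b ab with toSum (onEdge? u x a b)
      ... | inj₁ e = trans (recolorEdge-on e) (sym (recolorEdge-on (OnEdge-sym e)))
      ... | inj₂ ¬e = trans (recolorEdge-off ¬e)
                      (trans (symmetric a b ab) (sym (recolorEdge-off (¬e ∘ OnEdge-sym))))

      β-distinct : ∀ a y z → Adj G a y → Adj G a z → y ≢ z → β a y ≢ β a z
      β-distinct a y z ay az y≢z
        with toSum (onEdge? u x a y) | toSum (onEdge? u x a z)
      ... | inj₁ ey | inj₁ ez = λ _ → y≢z (OnEdge-unique ey ez)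
      ... | inj₁ ey | inj₂ ¬ez = λ same → c∉endpoint (OnEdge-start ey) z az
             (trans (sym (recolorEdge-off ¬ez)) (trans (sym same) (recolorEdge-on ey)))
      ... | inj₂ ¬ey | inj₁ ez = λ same → c∉endpoint (OnEdge-start ez) y ay
             (trans (sym (recolorEdge-off ¬ey)) (trans same (recolorEdge-on ez)))
      ... | inj₂ ¬ey | inj₂ ¬ez = λ same → distinct a y z ay az y≢z
             (trans (sym (recolorEdge-off ¬ey)) (trans same (recolorEdge-off ¬ez)))

    recolorEdge-KChange : KChange G α (recolorEdge α u x c)
    recolorEdge-KChange = c , α u x , c∉u x ux ∘ sym , u , λ a b ab →
        (λ r ≡c → ⊥-elim (c∉endpoint (chain⊆edge r) b ab ≡c))
      , (λ r ≡αux → recolorEdge-on (colour-OnEdge (chain⊆edge r) ab ≡αux))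
      , λ { (inj₁ ¬r)         → recolorEdge-off (¬r ∘ edge⊆chain ∘ OnEdge-start)
          ; (inj₂ (_ , ≢αux)) → recolorEdge-off (≢αux ∘ OnEdge-colour) }

  -- col i plays the role of m_α(x_i); only its values on the fan matter.
  record PathFan (α : Coloring G {k}) (u : Fin V) (p : ℕ)
                 (xs : Fin (suc p) → Fin V) (col : Fin (suc p) → Fin k) : Set where
    field
      adjacent  : ∀ i → Adj G u (xs i)
      injective : ∀ i j → xs i ≡ xs j → i ≡ j
      missing   : ∀ i → Missing G α (xs i) (col i)
      linked    : ∀ (i : Fin p) → col (inject₁ i) ≡ α u (xs (suc i))
      open-end  : Missing G α u (col (fromℕ p))

  record IsFanShift (α α' : Coloring G {k}) (u : Fin V) (p : ℕ)
                    (xs : Fin (suc p) → Fin V) (col : Fin (suc p) → Fin k) : Set where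
    field
      on-fanˡ : ∀ i → α' u (xs i) ≡ col i
      on-fanʳ : ∀ i → α' (xs i) u ≡ col i
      off-fan : ∀ a b → Adj G a b → (∀ i → ¬ OnEdge u (xs i) a b) → α' a b ≡ α a b

    on-fan : ∀ {i a b} → OnEdge u (xs i) a b → α' a b ≡ col i
    on-fan (inj₁ (refl , refl)) = on-fanˡ _
    on-fan (inj₂ (refl , refl)) = on-fanʳ _

  module _ {α : Coloring G {k}} {u : Fin V} {p : ℕ}
           {xs : Fin (suc (suc p)) → Fin V} {col : Fin (suc (suc p)) → Fin k} where
    private
      last = fromℕ (suc p)

      β : Coloring G {k}
      β = recolorEdge α u (xs last) (col last)

      β-on : ∀ {a b} → OnEdge u (xs last) a b → β a b ≡ col last
      β-on = recolorEdge-on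

      β-off : ∀ {a b} → ¬ OnEdge u (xs last) a b → β a b ≡ α a b
      β-off = recolorEdge-off

    PathFan-init : IsProper G α → PathFan α u (suc p) xs col →
                   PathFan (recolorEdge α u (xs (fromℕ (suc p))) (col (fromℕ (suc p)))) u p
                           (xs ∘ inject₁) (col ∘ inject₁)
    PathFan-init proper fan = record
      { adjacent  = adjacent ∘ inject₁
      ; injective = λ i j → inject₁-injective ∘ injective _ _
      ; missing   = missing′
      ; linked    = linked′
      ; open-end  = open-end′
      }
      where
      open PathFan fan

      u≢last : u ≢ xs last
      u≢last = Adj⇒≢ (adjacent last)

      inner≢last : ∀ i → xs (inject₁ i) ≢ xs last
      inner≢last i = fromℕ≢inject₁ ∘ sym ∘ injective _ _

      missing′ : ∀ i → Missing G β (xs (inject₁ i)) (col (inject₁ i))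
      missing′ i y xy ≡col = missing (inject₁ i) y xy (trans (sym (β-off off)) ≡col)
        where
        off : ¬ OnEdge u (xs last) (xs (inject₁ i)) y
        off (inj₁ (≡u , _))    = Adj⇒≢ (adjacent (inject₁ i)) (sym ≡u)
        off (inj₂ (≡last , _)) = inner≢last i ≡last

      linked′ : ∀ (i : Fin p) → col (inject₁ (inject₁ i)) ≡ β u (xs (inject₁ (suc i)))
      linked′ i = trans (linked (inject₁ i)) (sym (β-off off))
        where
        off : ¬ OnEdge u (xs last) u (xs (inject₁ (suc i)))
        off (inj₁ (_ , ≡last)) = inner≢last (suc i) ≡last
        off (inj₂ (≡last , _)) = u≢last ≡last

      -- col of the new last leaf is α(u x_last), which is now free at u.
      open-end′ : Missing G β u (col (inject₁ (fromℕ p)))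
      open-end′ y uy ≡col with toSum (y ≟ xs last)
      ... | inj₁ refl = open-end (xs last) (adjacent last)
            (trans (sym (linked (fromℕ p))) (trans (sym ≡col) (β-on (inj₁ (refl , refl)))))
      ... | inj₂ y≢last = proj₂ proper u y (xs last) uy (adjacent last) y≢last
            (trans (sym (β-off off)) (trans ≡col (linked (fromℕ p))))
        where
        off : ¬ OnEdge u (xs last) u y
        off (inj₁ (_ , ≡last)) = y≢last ≡last
        off (inj₂ (≡last , _)) = u≢last ≡last

    IsFanShift-init : ∀ {α'} → IsFanShift α α' u (suc p) xs col →
                      IsFanShift (recolorEdge α u (xs (fromℕ (suc p))) (col (fromℕ (suc p)))) α' u p
                                 (xs ∘ inject₁) (col ∘ inject₁)
    IsFanShift-init {α'} shift = record
      { on-fanˡ = on-fanˡ ∘ inject₁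
      ; on-fanʳ = on-fanʳ ∘ inject₁
      ; off-fan = off-fan′
      }
      where
      open IsFanShift shift

      off-fan′ : ∀ a b → Adj G a b → (∀ i → ¬ OnEdge u (xs (inject₁ i)) a b) → α' a b ≡ β a b
      off-fan′ a b ab off-init with toSum (onEdge? u (xs last) a b)
      ... | inj₁ e  = trans (on-fan e) (sym (β-on e))
      ... | inj₂ ¬e = trans (off-fan a b ab off) (sym (β-off ¬e))
        where
        off : ∀ i → ¬ OnEdge u (xs i) a b
        off i with view i
        ... | ‵fromℕ     = ¬e
        ... | ‵inject₁ j = off-init j

  IsFanShift-single : ∀ {α α' u} {xs : Fin 1 → Fin V} {col : Fin 1 → Fin k} →
                      IsFanShift α α' u 0 xs col →
                      AgreeOnEdges G (recolorEdge α u (xs zero) (col zero)) α'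
  IsFanShift-single {u = u} {xs} shift a b ab with toSum (onEdge? u (xs zero) a b)
  ... | inj₁ e  = trans (recolorEdge-on e) (sym (IsFanShift.on-fan shift e))
  ... | inj₂ ¬e = trans (recolorEdge-off ¬e) (sym (IsFanShift.off-fan shift a b ab λ { zero → ¬e }))

  PathFan-shift-KEquivalent : ∀ {α α' u} p {xs col} → IsProper G α →
                              PathFan α u p xs col → IsFanShift α α' u p xs col →
                              KEquivalent G α α'
  PathFan-shift-KEquivalent zero proper fan shift =
    recolorEdge-KChange proper (adjacent zero) open-end (missing zero)
      ◅ᴷ AgreeOnEdges⇒KEquivalent (IsFanShift-single shift)
    where open PathFan fan
  PathFan-shift-KEquivalent (suc p) proper fan shift =
    recolorEdge-KChange proper (adjacent last) open-end (missing last)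
      ◅ᴷ PathFan-shift-KEquivalent p (recolorEdge-proper proper (adjacent last) open-end (missing last))
           (PathFan-init proper fan) (IsFanShift-init shift)
    where
    open PathFan fan
    last = fromℕ (suc p)

lemma2p1 : (G : Graph) →
    (α : Coloring G {suc (maxDegree G)}) → IsProper G α →
    (m : Fin (Graph.n G) → Fin (suc (maxDegree G))) → (∀ x → Missing G α x (m x)) →
    (u v : Fin (Graph.n G)) → Adj G u v →
    (p : ℕ) → (xs : Fin (suc p) → Fin (Graph.n G)) → IsFan G α m u v p xs →
    Missing G α u (m (xs (fromℕ p))) →
    (α' : Coloring G {suc (maxDegree G)}) →
    (∀ i → α' u (xs i) ≡ m (xs i)) →
    (∀ i → α' (xs i) u ≡ m (xs i)) →
    (∀ a b → Adj G a b → (∀ i → ¬ ((a ≡ u × b ≡ xs i) ⊎ (a ≡ xs i × b ≡ u))) → α' a b ≡ α a b) →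
    KEquivalent G α α'
lemma2p1 G α proper m m-missing u _ _ p xs (_ , adjacent , injective , linked , _) open-end
         α' on-fanˡ on-fanʳ off-fan =
  PathFan-shift-KEquivalent G p proper
    (record { adjacent = adjacent ; injective = injective ; missing = m-missing ∘ xs
            ; linked = linked ; open-end = open-end })
    (record { on-fanˡ = on-fanˡ ; on-fanʳ = on-fanʳ ; off-fan = off-fan })
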